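{- Let $k=\mathbb{F}_q$ with $q=2^n$ a square, and $k_2=\mathbb{F}_{q^2}$. (a) If $q>4$, then among the elements $\operatorname{Tr}_{k_2/k}(x)$ with $x$ a cube of $k_2^*$ lying in $k_2\setminus k$, there are both cubes and non-cubes of $k^*$. If $q=4$, then $\operatorname{Tr}_{k_2/k}(x)$ is a non-cube of $k^*$ for every cube $x\in k_2\setminus k$. (b) Among the elements $\operatorname{Tr}_{k_2/k}(x)$ with $x$ a non-cube of $k_2^*$ lying in $k_2\setminus k$, there are both cubes and non-cubes of $k^*$. -}

module Defs where

open import Level using (0ℓ)
open import Data.Nat using (ℕ)
import Data.Nat as ℕ
open import Data.Fin using (Fin)
open import Data.Product using (Σ; _×_; ∃)
open import Relation.Nullary using (¬_)
open import Algebra.Bundles using (CommutativeRing)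
open import Function.Bundles using (Bijection)
import Relation.Binary.PropositionalEquality as ≡

record FiniteField (card : ℕ) : Set₁ where
  field
    commRing : CommutativeRing 0ℓ 0ℓ
  open CommutativeRing commRing public
  field
    1≉0     : ¬ (1# ≈ 0#)
    inverse : ∀ x → ¬ (x ≈ 0#) → ∃ λ y → x * y ≈ 1#
    enum    : Bijection setoid (≡.setoid (Fin card))

module FieldNotions {card : ℕ} (K : FiniteField card) (q : ℕ) where
  open FiniteField K
  open import Algebra.Properties.Semiring.Exp semiring public using (_^_)

  -- K plays the role of k₂ = F_{q²}; its subfield k = F_q is
  -- { x ∈ K | x^q = x }.
  Inₖ : Carrier → Set
  Inₖ x = x ^ q ≈ x

  Tr : Carrier → Carrier
  Tr x = x + x ^ q

  CubeK₂ : Carrier → Set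
  CubeK₂ x = ∃ λ y → ¬ (y ≈ 0#) × (y ^ 3 ≈ x)

  NonCubeK₂ : Carrier → Set
  NonCubeK₂ x = ¬ (x ≈ 0#) × ¬ CubeK₂ x

  Cubeₖ : Carrier → Set
  Cubeₖ t = ∃ λ y → Inₖ y × ¬ (y ≈ 0#) × (y ^ 3 ≈ t)

  NonCubeₖ : Carrier → Set
  NonCubeₖ t = Inₖ t × ¬ (t ≈ 0#) × ¬ Cubeₖ t

-- Let k = {x | x ^ q = x}, f = (q - 1) / 3 and e = (q + 1) f, so that q² - 1 = 3e: cubes x of K*
-- satisfy x ^ e = 1 and cubes t of k* satisfy t ^ f = 1. Fix v with Tr v = 1. For a ∈ k, w = v + a
-- again has trace 1, and its norm N w = w ^ (q + 1) equals w + w² = (a² + a) + N v ∈ k, so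
-- w ^ e = (N w) ^ f. On k, a ↦ (N (v + a)) ^ f is a polynomial of degree 2f < q, so a can be
-- chosen with (N w) ^ f ≠ c for any prescribed c. This gives a non-cube w with cube trace 1, a cube
-- w ^ (3f + 3) = N w · w with non-cube trace N w, and, for a non-cube t of k, a non-cube t w with
-- non-cube trace t.
-- The cube w³ has trace 1 + N w. By additive Hilbert 90 (b is a² + a for some a ∈ k iff its
-- absolute trace vanishes, and the absolute trace of 1 vanishes as q is a square) this equals z³
-- as soon as z³ and N v have the same absolute trace; for q > 4 such a z ∈ k* exists since
-- z ↦ absTr (z³) is a polynomial of degree 3q/4 < q on k. For q = 4 one has e = 5 and f = 1, and
-- x⁵ = 1 = x + x⁴ forces x = 1.

{-# OPTIONS --safe #-}
module Submission where

open import Data.Nat as ℕ using (ℕ; zero; suc; z≤n; s≤s; NonZero; ≢-nonZero⁻¹)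
import Data.Nat.Properties as ℕ
open import Data.Nat.Solver using (module +-*-Solver)
open import Data.Nat.Divisibility using (_∣_; divides; m∣m*n; ∣-trans)
open import Data.Fin using (Fin; zero; suc)
import Data.Fin.Properties as Fin
open import Data.Product using (Σ; _×_; ∃; _,_; proj₁; proj₂)
open import Data.Sum using (_⊎_; inj₁; inj₂; [_,_]′)
open import Data.Empty using (⊥-elim)
open import Data.Unit using (tt)
open import Data.List using (List; []; _∷_; length; filter; tabulate)
open import Data.List.Relation.Unary.All as All using (All; []; _∷_)
import Data.List.Relation.Unary.All.Properties as All
open import Data.List.Relation.Unary.Any as Any using (Any; here; there)
import Data.List.Relation.Unary.Any.Properties as Any
open import Data.List.Relation.Unary.AllPairs using ([]; _∷_)
import Data.List.Properties as ListP
open import Relation.Nullary using (¬_; Dec; yes; no)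
open import Relation.Unary using (Pred; Decidable)
open import Relation.Unary.Properties using (∁?)
open import Relation.Binary.PropositionalEquality as ≡ using (_≡_; _≢_)
open import Function using (_∘_; id)
open import Function.Bundles using (Bijection)
open import Algebra.Bundles using (CommutativeSemiring; CommutativeRing)
open import Defs

-- cubeIndex m = (4 ^ m ∸ 1) / 3
cubeIndex : ℕ → ℕ
cubeIndex zero    = 0
cubeIndex (suc m) = suc (4 ℕ.* cubeIndex m)

module _ where
  open +-*-Solver

  4^m≡1+3*cubeIndex : ∀ m → 2 ℕ.^ (2 ℕ.* m) ≡ suc (3 ℕ.* cubeIndex m)
  4^m≡1+3*cubeIndex zero    = ≡.refl
  4^m≡1+3*cubeIndex (suc m) = begin
    2 ℕ.^ (2 ℕ.* suc m)
      ≡⟨ ≡.cong (2 ℕ.^_) (ℕ.*-suc 2 m) ⟩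
    2 ℕ.* (2 ℕ.* 2 ℕ.^ (2 ℕ.* m))
      ≡⟨ ℕ.*-assoc 2 2 (2 ℕ.^ (2 ℕ.* m)) ⟨
    4 ℕ.* 2 ℕ.^ (2 ℕ.* m)
      ≡⟨ ≡.cong (4 ℕ.*_) (4^m≡1+3*cubeIndex m) ⟩
    4 ℕ.* suc (3 ℕ.* c)
      ≡⟨ solve 1 (λ c → con 4 :* (con 1 :+ con 3 :* c) := con 1 :+ con 3 :* (con 1 :+ con 4 :* c)) ≡.refl c ⟩
    suc (3 ℕ.* suc (4 ℕ.* c)) ∎
    where
    open ≡.≡-Reasoning
    c = cubeIndex m

  3*m≡2*m+m : ∀ m → 3 ℕ.* m ≡ 2 ℕ.* m ℕ.+ m
  3*m≡2*m+m = solve 1 (λ m → con 3 :* m := con 2 :* m :+ m) ≡.refl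

  3*m+m≡2*[2*m] : ∀ m → 3 ℕ.* m ℕ.+ m ≡ 2 ℕ.* (2 ℕ.* m)
  3*m+m≡2*[2*m] = solve 1 (λ m → con 3 :* m :+ m := con 2 :* (con 2 :* m)) ≡.refl

  [1+3f]²∸1≡3*[2+3f]*f : ∀ f →
    ℕ.pred (suc (3 ℕ.* f) ℕ.* suc (3 ℕ.* f)) ≡ 3 ℕ.* (suc (suc (3 ℕ.* f)) ℕ.* f)
  [1+3f]²∸1≡3*[2+3f]*f = solve 1 (λ f → con 3 :* f :+ con 3 :* f :* (con 1 :+ con 3 :* f) := con 3 :* ((con 2 :+ con 3 :* f) :* f)) ≡.refl

length≤filter+reject : ∀ {a p} {A : Set a} {P : Pred A p} (P? : Decidable P) xs →
                       length xs ℕ.≤ length (filter P? xs) ℕ.+ length (filter (∁? P?) xs)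
length≤filter+reject P? []       = z≤n
length≤filter+reject P? (x ∷ xs) with P? x
... | yes _ = s≤s (length≤filter+reject P? xs)
... | no _  = ℕ.≤-trans (s≤s (length≤filter+reject P? xs)) (ℕ.≤-reflexive (≡.sym (ℕ.+-suc _ _)))

module _ {c ℓ} (S : CommutativeSemiring c ℓ) where
  open CommutativeSemiring S
  open import Algebra.Properties.CommutativeSemiring.Exp S using (_^_)

  1^n≈1 : ∀ n → 1# ^ n ≈ 1#
  1^n≈1 zero    = refl
  1^n≈1 (suc n) = trans (*-identityˡ _) (1^n≈1 n)

Characteristic2 : ∀ {c ℓ} → CommutativeRing c ℓ → Set ℓ
Characteristic2 R = 1# + 1# ≈ 0#
  where open CommutativeRing R

module FiniteFieldProperties {card : ℕ} (K : FiniteField card) where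
  open FiniteField K hiding (zero)
  open import Algebra.Properties.CommutativeSemiring.Exp commutativeSemiring
    using (_^_; ^-congˡ; ^-congʳ; ^-assocʳ)
  open import Relation.Binary.Reasoning.Setoid setoid
  open import Data.List.Relation.Unary.Unique.Setoid setoid using (Unique)
  import Data.List.Relation.Unary.Unique.Setoid.Properties as Unique
  open import Data.List.Membership.Setoid setoid using (_∈_)
  open Bijection enum using (injective; strictlySurjective) renaming (to to toFin; cong to toFin-cong)

  fromFin : Fin card → Carrier
  fromFin i = proj₁ (strictlySurjective i)

  toFin-fromFin : ∀ i → toFin (fromFin i) ≡ i
  toFin-fromFin i = proj₂ (strictlySurjective i)

  fromFin-toFin : ∀ x → fromFin (toFin x) ≈ x
  fromFin-toFin x = injective (toFin-fromFin (toFin x))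

  fromFin-injective : ∀ {i j} → fromFin i ≈ fromFin j → i ≡ j
  fromFin-injective {i} {j} eq = ≡.trans (≡.sym (toFin-fromFin i)) (≡.trans (toFin-cong eq) (toFin-fromFin j))

  infix 4 _≟_
  _≟_ : ∀ x y → Dec (x ≈ y)
  x ≟ y with toFin x Fin.≟ toFin y
  ... | yes eq = yes (injective eq)
  ... | no neq = no (λ eq → neq (toFin-cong eq))

  elements : List Carrier
  elements = tabulate fromFin

  elements-unique : Unique elements
  elements-unique = Unique.tabulate⁺ setoid fromFin-injective

  ∈-elements : ∀ x → x ∈ elements
  ∈-elements x = Any.tabulate⁺ (toFin x) (sym (fromFin-toFin x))

  length-elements : length elements ≡ card
  length-elements = ListP.length-tabulate fromFin

  inverse-of : ∀ {x} → x ≉ 0# → Carrier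
  inverse-of nz = proj₁ (inverse _ nz)

  x*x⁻¹≈1 : ∀ {x} (nz : x ≉ 0#) → x * inverse-of nz ≈ 1#
  x*x⁻¹≈1 nz = proj₂ (inverse _ nz)

  *-cancelˡ : ∀ {x y z} → x ≉ 0# → x * y ≈ x * z → y ≈ z
  *-cancelˡ {x} {y} {z} nz eq = begin
    y                 ≈⟨ *-identityˡ y ⟨
    1# * y            ≈⟨ *-congʳ (trans (*-comm _ _) (x*x⁻¹≈1 nz)) ⟨
    (x⁻¹ * x) * y     ≈⟨ *-assoc _ _ _ ⟩
    x⁻¹ * (x * y)     ≈⟨ *-congˡ eq ⟩
    x⁻¹ * (x * z)     ≈⟨ *-assoc _ _ _ ⟨
    (x⁻¹ * x) * z     ≈⟨ *-congʳ (trans (*-comm _ _) (x*x⁻¹≈1 nz)) ⟩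
    1# * z            ≈⟨ *-identityˡ z ⟩
    z                 ∎
    where x⁻¹ = inverse-of nz

  *-≉0 : ∀ {x y} → x ≉ 0# → y ≉ 0# → x * y ≉ 0#
  *-≉0 {x} nx ny xy≈0 = ny (*-cancelˡ nx (trans xy≈0 (sym (zeroʳ x))))

  x*y≈0⇒x≈0⊎y≈0 : ∀ {x y} → x * y ≈ 0# → x ≈ 0# ⊎ y ≈ 0#
  x*y≈0⇒x≈0⊎y≈0 {x} {y} xy≈0 with x ≟ 0# | y ≟ 0#
  ... | yes x≈0 | _      = inj₁ x≈0
  ... | no _    | yes y≈0 = inj₂ y≈0
  ... | no nx   | no ny   = ⊥-elim (*-≉0 nx ny xy≈0)

  ^-≉0 : ∀ {x} n → x ≉ 0# → x ^ n ≉ 0#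
  ^-≉0 zero    nz = 1≉0
  ^-≉0 (suc n) nz = *-≉0 nz (^-≉0 n nz)

  card≢0 : NonZero card
  card≢0 = Fin.nonZeroIndex (toFin 0#)

  module _ where
    open import Algebra.Properties.CommutativeMonoid.Sum *-commutativeMonoid
      using (∑-permute; ∑-distrib-+; sum-cong-≋) renaming (sum to prod)
    open import Data.Fin.Permutation using (Permutation; permutation)

    nonzeroPart : Carrier → Carrier
    nonzeroPart x with x ≟ 0#
    ... | yes _ = 1#
    ... | no _  = x

    nonzeroPart-≉0 : ∀ x → nonzeroPart x ≉ 0#
    nonzeroPart-≉0 x with x ≟ 0#
    ... | yes _ = 1≉0
    ... | no nz = nz

    nonzeroPart-cong : ∀ {x y} → x ≈ y → nonzeroPart x ≈ nonzeroPart y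
    nonzeroPart-cong {x} {y} x≈y with x ≟ 0# | y ≟ 0#
    ... | yes _   | yes _   = refl
    ... | yes x≈0 | no y≉0  = ⊥-elim (y≉0 (trans (sym x≈y) x≈0))
    ... | no x≉0  | yes y≈0 = ⊥-elim (x≉0 (trans x≈y y≈0))
    ... | no _    | no _    = x≈y

    scaleFactor : Carrier → Carrier → Carrier
    scaleFactor a x with x ≟ 0#
    ... | yes _ = 1#
    ... | no _  = a

    nonzeroPart-* : ∀ {a} x → a ≉ 0# → nonzeroPart (a * x) ≈ scaleFactor a x * nonzeroPart x
    nonzeroPart-* {a} x na with x ≟ 0# | a * x ≟ 0#
    ... | yes _   | yes _    = sym (*-identityˡ 1#)
    ... | yes x≈0 | no ax≉0  = ⊥-elim (ax≉0 (trans (*-congˡ x≈0) (zeroʳ a)))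
    ... | no x≉0  | yes ax≈0 = ⊥-elim (*-≉0 na x≉0 ax≈0)
    ... | no _    | no _     = refl

    prod-≉0 : ∀ {n} (v : Fin n → Carrier) → (∀ i → v i ≉ 0#) → prod v ≉ 0#
    prod-≉0 {zero}  v nz = 1≉0
    prod-≉0 {suc n} v nz = *-≉0 (nz zero) (prod-≉0 (λ i → v (suc i)) (λ i → nz (suc i)))

    prod-const : ∀ {a n} (v : Fin n → Carrier) → (∀ i → v i ≈ a) → prod v ≈ a ^ n
    prod-const {n = zero}  v eq = refl
    prod-const {n = suc n} v eq = *-cong (eq zero) (prod-const (λ i → v (suc i)) (λ i → eq (suc i)))

    prod-const-but-one : ∀ {a n} (v : Fin n → Carrier) (z : Fin n) → v z ≈ 1# →
                         (∀ i → i ≢ z → v i ≈ a) → prod v ≈ a ^ ℕ.pred n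
    prod-const-but-one {n = suc n} v zero vz≈1 eq =
      trans (*-cong vz≈1 (prod-const (λ i → v (suc i)) (λ i → eq (suc i) (λ ())))) (*-identityˡ _)
    prod-const-but-one {n = suc (suc n)} v (suc z) vz≈1 eq =
      *-cong (eq zero (λ ())) (prod-const-but-one (λ i → v (suc i)) z vz≈1
                                 (λ i i≢z → eq (suc i) (λ si≡sz → i≢z (Fin.suc-injective si≡sz))))

    multiplication-permutation : ∀ {a} → a ≉ 0# → Permutation card card
    multiplication-permutation {a} na =
      permutation (λ i → toFin (a * fromFin i)) (λ i → toFin (a⁻¹ * fromFin i))
                  (cancel (x*x⁻¹≈1 na)) (cancel (trans (*-comm _ _) (x*x⁻¹≈1 na)))
      where
      a⁻¹ = inverse-of na
      cancel : ∀ {b c} → b * c ≈ 1# → ∀ i → toFin (b * fromFin (toFin (c * fromFin i))) ≡ i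
      cancel {b} {c} bc≈1 i = ≡.trans (toFin-cong (begin
        b * fromFin (toFin (c * fromFin i))  ≈⟨ *-congˡ (fromFin-toFin _) ⟩
        b * (c * fromFin i)                  ≈⟨ *-assoc _ _ _ ⟨
        (b * c) * fromFin i                  ≈⟨ *-congʳ bc≈1 ⟩
        1# * fromFin i                       ≈⟨ *-identityˡ _ ⟩
        fromFin i                            ∎)) (toFin-fromFin i)

    -- x ↦ a x permutes K and multiplies the product of the nonzero parts by a ^ (card - 1).
    fermat : ∀ {a} → a ≉ 0# → a ^ ℕ.pred card ≈ 1#
    fermat {a} na = *-cancelˡ (prod-≉0 (nonzeroPart ∘ fromFin) (nonzeroPart-≉0 ∘ fromFin)) (begin
      P * a ^ ℕ.pred card
        ≈⟨ *-comm _ _ ⟩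
      a ^ ℕ.pred card * P
        ≈⟨ *-congʳ (prod-const-but-one (scaleFactor a ∘ fromFin) (toFin 0#) factor-at-0 factor-elsewhere) ⟨
      prod (scaleFactor a ∘ fromFin) * P
        ≈⟨ ∑-distrib-+ (scaleFactor a ∘ fromFin) (nonzeroPart ∘ fromFin) ⟨
      prod (λ i → scaleFactor a (fromFin i) * nonzeroPart (fromFin i))
        ≈⟨ sum-cong-≋ (λ i → nonzeroPart-* (fromFin i) na) ⟨
      prod (λ i → nonzeroPart (a * fromFin i))
        ≈⟨ sum-cong-≋ (λ i → nonzeroPart-cong (fromFin-toFin (a * fromFin i))) ⟨
      prod (λ i → nonzeroPart (fromFin (toFin (a * fromFin i))))
        ≈⟨ ∑-permute (nonzeroPart ∘ fromFin) (multiplication-permutation na) ⟨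
      P
        ≈⟨ *-identityʳ P ⟨
      P * 1# ∎)
      where
      P = prod (nonzeroPart ∘ fromFin)
      factor-at-0 : scaleFactor a (fromFin (toFin 0#)) ≈ 1#
      factor-at-0 with fromFin (toFin 0#) ≟ 0#
      ... | yes _   = refl
      ... | no x≉0  = ⊥-elim (x≉0 (fromFin-toFin 0#))
      factor-elsewhere : ∀ i → i ≢ toFin 0# → scaleFactor a (fromFin i) ≈ a
      factor-elsewhere i i≢0 with fromFin i ≟ 0#
      ... | yes x≈0 = ⊥-elim (i≢0 (≡.trans (≡.sym (toFin-fromFin i)) (toFin-cong x≈0)))
      ... | no _    = refl

  x^card≈x : ∀ x → x ^ card ≈ x
  x^card≈x x = trans (^-congʳ x (≡.sym (ℕ.suc-pred card {{card≢0}}))) (x*x^pred[card]≈x (x ≟ 0#))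
    where
    x*x^pred[card]≈x : Dec (x ≈ 0#) → x * x ^ ℕ.pred card ≈ x
    x*x^pred[card]≈x (yes x≈0) = trans (*-congʳ x≈0) (trans (zeroˡ _) (sym x≈0))
    x*x^pred[card]≈x (no x≉0)  = trans (*-congˡ (fermat x≉0)) (*-identityʳ x)

  -- Fermat's little theorem at -1 with the odd exponent card - 1.
  char-2 : 2 ∣ card → Characteristic2 commRing
  char-2 (divides zero card≡0) = ⊥-elim (≢-nonZero⁻¹ card {{card≢0}} card≡0)
  char-2 (divides (suc k) card≡[1+k]*2) = begin
    1# + 1#     ≈⟨ +-congˡ -1≈1 ⟨
    1# + - 1#   ≈⟨ -‿inverseʳ 1# ⟩
    0#          ∎
    where
    open import Algebra.Properties.Ring ring using (-1*x≈-x)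
    open import Algebra.Properties.AbelianGroup +-abelianGroup using (⁻¹-involutive; ε⁻¹≈ε)
    -1≉0 : - 1# ≉ 0#
    -1≉0 -1≈0 = 1≉0 (trans (sym (⁻¹-involutive 1#)) (trans (-‿cong -1≈0) ε⁻¹≈ε))
    [-1]²≈1 : (- 1#) ^ 2 ≈ 1#
    [-1]²≈1 = trans (*-congˡ (*-identityʳ _)) (trans (-1*x≈-x (- 1#)) (⁻¹-involutive 1#))
    -1≈1 : - 1# ≈ 1#
    -1≈1 = begin
      - 1#                       ≈⟨ *-identityʳ _ ⟨
      - 1# * 1#                  ≈⟨ *-congˡ (trans (^-congˡ k [-1]²≈1) (1^n≈1 commutativeSemiring k)) ⟨
      - 1# * ((- 1#) ^ 2) ^ k    ≈⟨ *-congˡ (^-assocʳ (- 1#) 2 k) ⟩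
      - 1# * (- 1#) ^ (2 ℕ.* k)  ≡⟨ ≡.cong (λ i → (- 1#) ^ suc i) (ℕ.*-comm 2 k) ⟩
      (- 1#) ^ suc (k ℕ.* 2)     ≡⟨ ≡.cong (λ c → (- 1#) ^ ℕ.pred c) card≡[1+k]*2 ⟨
      (- 1#) ^ ℕ.pred card       ≈⟨ fermat -1≉0 ⟩
      1#                         ∎

module Characteristic2Properties {c ℓ} (R : CommutativeRing c ℓ) (char2 : Characteristic2 R) where
  open CommutativeRing R hiding (zero)
  open import Algebra.Properties.CommutativeSemiring.Exp commutativeSemiring
    using (_^_; ^-congˡ; ^-congʳ; ^-assocʳ; ^-distrib-*)
  open import Relation.Binary.Reasoning.Setoid setoid
  open import Algebra.Solver.Ring.NaturalCoefficients.Default commutativeSemiring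

  x+x≈0 : ∀ x → x + x ≈ 0#
  x+x≈0 x = begin
    x + x           ≈⟨ solve 1 (λ x → x :+ x := (con 1 :+ con 1) :* x) refl x ⟩
    (1# + 1#) * x   ≈⟨ *-congʳ char2 ⟩
    0# * x          ≈⟨ zeroˡ x ⟩
    0#              ∎

  x+[y+y]≈x : ∀ x y → x + (y + y) ≈ x
  x+[y+y]≈x x y = trans (+-congˡ (x+x≈0 y)) (+-identityʳ x)

  x+y≈0⇒x≈y : ∀ {x y} → x + y ≈ 0# → x ≈ y
  x+y≈0⇒x≈y {x} {y} x+y≈0 = begin
    x             ≈⟨ x+[y+y]≈x x y ⟨
    x + (y + y)   ≈⟨ +-assoc _ _ _ ⟨
    (x + y) + y   ≈⟨ +-congʳ x+y≈0 ⟩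
    0# + y        ≈⟨ +-identityˡ y ⟩
    y             ∎

  x≈y⇒x+y≈0 : ∀ {x y} → x ≈ y → x + y ≈ 0#
  x≈y⇒x+y≈0 {y = y} x≈y = trans (+-congʳ x≈y) (x+x≈0 y)

  [x+y]²≈x²+y² : ∀ x y → (x + y) ^ 2 ≈ x ^ 2 + y ^ 2
  [x+y]²≈x²+y² x y = begin
    (x + y) ^ 2
      ≈⟨ solve 2 (λ x y → (x :+ y) :* ((x :+ y) :* con 1) := (x :* (x :* con 1) :+ y :* (y :* con 1)) :+ (x :* y :+ x :* y)) refl x y ⟩
    (x ^ 2 + y ^ 2) + (x * y + x * y)
      ≈⟨ x+[y+y]≈x _ _ ⟩
    x ^ 2 + y ^ 2 ∎

  x^[2*n]≈[x^n]² : ∀ x n → x ^ (2 ℕ.* n) ≈ (x ^ n) ^ 2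
  x^[2*n]≈[x^n]² x n = trans (^-congʳ x (ℕ.*-comm 2 n)) (sym (^-assocʳ x n 2))

  frobenius : ∀ j x y → (x + y) ^ (2 ℕ.^ j) ≈ x ^ (2 ℕ.^ j) + y ^ (2 ℕ.^ j)
  frobenius zero x y = solve 2 (λ x y → (x :+ y) :* con 1 := x :* con 1 :+ y :* con 1) refl x y
  frobenius (suc j) x y = begin
    (x + y) ^ (2 ℕ.* 2 ℕ.^ j)
      ≈⟨ x^[2*n]≈[x^n]² (x + y) (2 ℕ.^ j) ⟩
    ((x + y) ^ (2 ℕ.^ j)) ^ 2
      ≈⟨ ^-congˡ 2 (frobenius j x y) ⟩
    (x ^ (2 ℕ.^ j) + y ^ (2 ℕ.^ j)) ^ 2
      ≈⟨ [x+y]²≈x²+y² _ _ ⟩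
    (x ^ (2 ℕ.^ j)) ^ 2 + (y ^ (2 ℕ.^ j)) ^ 2
      ≈⟨ +-cong (x^[2*n]≈[x^n]² x (2 ℕ.^ j)) (x^[2*n]≈[x^n]² y (2 ℕ.^ j)) ⟨
    x ^ (2 ℕ.* 2 ℕ.^ j) + y ^ (2 ℕ.* 2 ℕ.^ j) ∎

  x⁵≈1⇒x+x⁴≈1⇒x≈1 : ∀ x → x ^ 5 ≈ 1# → x + x ^ 4 ≈ 1# → x ≈ 1#
  x⁵≈1⇒x+x⁴≈1⇒x≈1 x x⁵≈1 x+x⁴≈1 = begin
    x                 ≈⟨ *-identityʳ x ⟨
    x * 1#            ≈⟨ *-congˡ x²≈1 ⟨
    x * (x * x)       ≈⟨ x³≈1 ⟩
    1#                ∎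
    where
    x²+x+1≈0 : (x * x + x) + 1# ≈ 0#
    x²+x+1≈0 = x≈y⇒x+y≈0 (begin
      x * x + x
        ≈⟨ +-congˡ (trans (*-congˡ x+x⁴≈1) (*-identityʳ x)) ⟨
      x * x + x * (x + x ^ 4)
        ≈⟨ solve 1 (λ x → x :* x :+ x :* (x :+ x :* (x :* (x :* (x :* con 1)))) := x :* (x :* (x :* (x :* (x :* con 1)))) :+ (x :* x :+ x :* x)) refl x ⟩
      x ^ 5 + (x * x + x * x)
        ≈⟨ x+[y+y]≈x _ _ ⟩
      x ^ 5
        ≈⟨ x⁵≈1 ⟩
      1# ∎)
    x³≈1 : x * (x * x) ≈ 1#
    x³≈1 = x+y≈0⇒x≈y (begin
      x * (x * x) + 1#
        ≈⟨ x+[y+y]≈x _ _ ⟨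
      (x * (x * x) + 1#) + ((x * x + x) + (x * x + x))
        ≈⟨ solve 1 (λ x → (x :* (x :* x) :+ con 1) :+ ((x :* x :+ x) :+ (x :* x :+ x)) := (x :+ con 1) :* ((x :* x :+ x) :+ con 1)) refl x ⟩
      (x + 1#) * ((x * x + x) + 1#)
        ≈⟨ *-congˡ x²+x+1≈0 ⟩
      (x + 1#) * 0#
        ≈⟨ zeroʳ _ ⟩
      0# ∎)
    x²≈1 : x * x ≈ 1#
    x²≈1 = begin
      x * x
        ≈⟨ *-identityʳ _ ⟨
      (x * x) * 1#
        ≈⟨ *-congˡ x³≈1 ⟨
      (x * x) * (x * (x * x))
        ≈⟨ solve 1 (λ x → (x :* x) :* (x :* (x :* x)) := x :* (x :* (x :* (x :* (x :* con 1))))) refl x ⟩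
      x ^ 5
        ≈⟨ x⁵≈1 ⟩
      1# ∎

  -- Over a field with 2 ^ j elements, frobeniusSum j is the absolute trace.
  frobeniusSum : ℕ → Carrier → Carrier
  frobeniusSum zero    u = 0#
  frobeniusSum (suc j) u = frobeniusSum j u + u ^ (2 ℕ.^ j)

  frobeniusSum-cong : ∀ j {u v} → u ≈ v → frobeniusSum j u ≈ frobeniusSum j v
  frobeniusSum-cong zero    u≈v = refl
  frobeniusSum-cong (suc j) u≈v = +-cong (frobeniusSum-cong j u≈v) (^-congˡ (2 ℕ.^ j) u≈v)

  frobeniusSum-+ : ∀ j u v → frobeniusSum j (u + v) ≈ frobeniusSum j u + frobeniusSum j v
  frobeniusSum-+ zero    u v = sym (+-identityʳ 0#)
  frobeniusSum-+ (suc j) u v = begin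
    frobeniusSum j (u + v) + (u + v) ^ (2 ℕ.^ j)
      ≈⟨ +-cong (frobeniusSum-+ j u v) (frobenius j u v) ⟩
    (frobeniusSum j u + frobeniusSum j v) + (u ^ (2 ℕ.^ j) + v ^ (2 ℕ.^ j))
      ≈⟨ solve 4 (λ a b c d → (a :+ b) :+ (c :+ d) := (a :+ c) :+ (b :+ d)) refl _ _ _ _ ⟩
    frobeniusSum (suc j) u + frobeniusSum (suc j) v
      ∎

  frobeniusSum-0 : ∀ j → frobeniusSum j 0# ≈ 0#
  frobeniusSum-0 j = begin
    frobeniusSum j 0#                          ≈⟨ frobeniusSum-cong j (+-identityʳ 0#) ⟨
    frobeniusSum j (0# + 0#)                   ≈⟨ frobeniusSum-+ j 0# 0# ⟩
    frobeniusSum j 0# + frobeniusSum j 0#      ≈⟨ x+x≈0 _ ⟩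
    0#                                         ∎

  frobeniusSum-of-square : ∀ j u → frobeniusSum j (u * u) ≈ frobeniusSum j u ^ 2
  frobeniusSum-of-square zero    u = sym (zeroˡ _)
  frobeniusSum-of-square (suc j) u = begin
    frobeniusSum j (u * u) + (u * u) ^ (2 ℕ.^ j)
      ≈⟨ +-cong (frobeniusSum-of-square j u) (^-distrib-* u u (2 ℕ.^ j)) ⟩
    frobeniusSum j u ^ 2 + u ^ (2 ℕ.^ j) * u ^ (2 ℕ.^ j)
      ≈⟨ +-congˡ (*-congˡ (*-identityʳ _)) ⟨
    frobeniusSum j u ^ 2 + (u ^ (2 ℕ.^ j)) ^ 2
      ≈⟨ [x+y]²≈x²+y² _ _ ⟨
    frobeniusSum (suc j) u ^ 2 ∎

  square-of-frobeniusSum : ∀ j u → frobeniusSum j u ^ 2 ≈ frobeniusSum (suc j) u + u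
  square-of-frobeniusSum zero    u = begin
    0# ^ 2                         ≈⟨ zeroˡ _ ⟩
    0#                             ≈⟨ x+x≈0 u ⟨
    u + u                          ≈⟨ +-congʳ (trans (+-identityˡ _) (*-identityʳ u)) ⟨
    (0# + u * 1#) + u              ∎
  square-of-frobeniusSum (suc j) u = begin
    (frobeniusSum j u + U) ^ 2
      ≈⟨ [x+y]²≈x²+y² _ _ ⟩
    frobeniusSum j u ^ 2 + U ^ 2
      ≈⟨ +-cong (square-of-frobeniusSum j u) (sym (x^[2*n]≈[x^n]² u (2 ℕ.^ j))) ⟩
    ((frobeniusSum j u + U) + u) + u ^ (2 ℕ.* 2 ℕ.^ j)
      ≈⟨ solve 4 (λ a b c d → ((a :+ b) :+ c) :+ d := ((a :+ b) :+ d) :+ c) refl _ _ _ _ ⟩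
    frobeniusSum (suc (suc j)) u + u                ∎
    where U = u ^ (2 ℕ.^ j)

  frobeniusSum-1 : ∀ {j} → 2 ∣ j → frobeniusSum j 1# ≈ 0#
  frobeniusSum-1 (divides k ≡.refl) = go k
    where
    go : ∀ k → frobeniusSum (k ℕ.* 2) 1# ≈ 0#
    go zero    = refl
    go (suc k) = begin
      (frobeniusSum (k ℕ.* 2) 1# + 1# ^ (2 ℕ.^ (k ℕ.* 2))) + 1# ^ (2 ℕ.^ suc (k ℕ.* 2))
        ≈⟨ +-cong (+-cong (go k) (1^n≈1 commutativeSemiring (2 ℕ.^ (k ℕ.* 2)))) (1^n≈1 commutativeSemiring (2 ℕ.^ suc (k ℕ.* 2))) ⟩
      (0# + 1#) + 1#                                  ≈⟨ +-congʳ (+-identityˡ 1#) ⟩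
      1# + 1#                                         ≈⟨ char2 ⟩
      0#                                              ∎

module PolynomialFunctions {card : ℕ} (K : FiniteField card)
                           (char2 : Characteristic2 (FiniteField.commRing K)) where
  open FiniteField K hiding (zero)
  open FiniteFieldProperties K
  open Characteristic2Properties commRing char2
  open import Algebra.Properties.CommutativeSemiring.Exp commutativeSemiring using (_^_)
  open import Relation.Binary.Reasoning.Setoid setoid
  open import Algebra.Solver.Ring.NaturalCoefficients.Default commutativeSemiring
  open import Data.List.Relation.Unary.Unique.Setoid setoid using (Unique)
  import Data.List.Relation.Unary.Unique.Setoid.Properties as Unique
  open import Data.List.Membership.Setoid setoid using (_∈_)

  -- Horner encoding: Poly n F says that F is a polynomial function of degree < n,
  -- Monic n F that it is a monic polynomial function of degree n.
  Poly : ℕ → (Carrier → Carrier) → Set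
  Poly zero    F = ∀ x → F x ≈ 0#
  Poly (suc n) F = Σ (Carrier → Carrier) λ G → Poly n G × Σ Carrier λ c → ∀ x → F x ≈ x * G x + c

  Monic : ℕ → (Carrier → Carrier) → Set
  Monic zero    F = ∀ x → F x ≈ 1#
  Monic (suc n) F = Σ (Carrier → Carrier) λ G → Monic n G × Σ Carrier λ c → ∀ x → F x ≈ x * G x + c

  Poly-cong : ∀ n {F G} → Poly n F → (∀ x → G x ≈ F x) → Poly n G
  Poly-cong zero    F≈0                G≈F x = trans (G≈F x) (F≈0 x)
  Poly-cong (suc n) (H , pH , c , F≈xH+c) G≈F = H , pH , c , λ x → trans (G≈F x) (F≈xH+c x)

  Monic-cong : ∀ n {F G} → Monic n F → (∀ x → G x ≈ F x) → Monic n G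
  Monic-cong zero    F≈1                G≈F x = trans (G≈F x) (F≈1 x)
  Monic-cong (suc n) (H , mH , c , F≈xH+c) G≈F = H , mH , c , λ x → trans (G≈F x) (F≈xH+c x)

  Poly-zero : ∀ n → Poly n (λ _ → 0#)
  Poly-zero zero    x = refl
  Poly-zero (suc n) = (λ _ → 0#) , Poly-zero n , 0# , λ x → sym (trans (+-identityʳ _) (zeroʳ x))

  Poly-const : ∀ n c → Poly (suc n) (λ _ → c)
  Poly-const n c = (λ _ → 0#) , Poly-zero n , c , λ x → sym (trans (+-congʳ (zeroʳ x)) (+-identityˡ c))

  Poly-+ : ∀ n {F G} → Poly n F → Poly n G → Poly n (λ x → F x + G x)
  Poly-+ zero    F≈0 G≈0 x = trans (+-cong (F≈0 x) (G≈0 x)) (+-identityˡ 0#)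
  Poly-+ (suc n) {F} {G} (F′ , pF′ , c , F≈) (G′ , pG′ , d , G≈) =
    (λ x → F′ x + G′ x) , Poly-+ n pF′ pG′ , c + d , λ x → trans (+-cong (F≈ x) (G≈ x))
      (solve 5 (λ x a b c d → (x :* a :+ c) :+ (x :* b :+ d) := x :* (a :+ b) :+ (c :+ d)) refl x (F′ x) (G′ x) c d)

  Poly-scale : ∀ n {F} a → Poly n F → Poly n (λ x → a * F x)
  Poly-scale zero    a F≈0 x = trans (*-congˡ (F≈0 x)) (zeroʳ a)
  Poly-scale (suc n) a (F′ , pF′ , c , F≈) =
    (λ x → a * F′ x) , Poly-scale n a pF′ , a * c , λ x → trans (*-congˡ (F≈ x))
      (solve 4 (λ a x f c → a :* (x :* f :+ c) := x :* (a :* f) :+ a :* c) refl a x (F′ x) c)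

  Poly-suc : ∀ n {F} → Poly n F → Poly (suc n) F
  Poly-suc zero    F≈0 =
    (λ _ → 0#) , (λ _ → refl) , 0# , λ x → trans (F≈0 x) (sym (trans (+-identityʳ _) (zeroʳ x)))
  Poly-suc (suc n) (G , pG , c , F≈) = G , Poly-suc n pG , c , F≈

  Poly-≤ : ∀ {m n F} → m ℕ.≤ n → Poly m F → Poly n F
  Poly-≤ {zero}  {zero}  z≤n       pF = pF
  Poly-≤ {zero}  {suc n} z≤n       pF = Poly-suc n (Poly-≤ z≤n pF)
  Poly-≤ {suc m} {suc n} (s≤s m≤n) (G , pG , c , F≈) = G , Poly-≤ m≤n pG , c , F≈

  Monic⇒Poly : ∀ n {F} → Monic n F → Poly (suc n) F
  Monic⇒Poly zero    F≈1 =
    (λ _ → 0#) , (λ _ → refl) , 1# , λ x → trans (F≈1 x) (sym (trans (+-congʳ (zeroʳ x)) (+-identityˡ 1#)))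
  Monic⇒Poly (suc n) (G , mG , c , F≈) = G , Monic⇒Poly n mG , c , F≈

  Monic-+-Poly : ∀ n {F G} → Monic n F → Poly n G → Monic n (λ x → F x + G x)
  Monic-+-Poly zero    F≈1 G≈0 x = trans (+-cong (F≈1 x) (G≈0 x)) (+-identityʳ 1#)
  Monic-+-Poly (suc n) (F′ , mF′ , c , F≈) (G′ , pG′ , d , G≈) =
    (λ x → F′ x + G′ x) , Monic-+-Poly n mF′ pG′ , c + d , λ x → trans (+-cong (F≈ x) (G≈ x))
      (solve 5 (λ x a b c d → (x :* a :+ c) :+ (x :* b :+ d) := x :* (a :+ b) :+ (c :+ d)) refl x (F′ x) (G′ x) c d)

  Monic-+-const : ∀ n {F} c .{{_ : NonZero n}} → Monic n F → Monic n (λ x → F x + c)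
  Monic-+-const (suc n) c mF = Monic-+-Poly (suc n) mF (Poly-const n c)

  Monic-x^n : ∀ n → Monic n (λ x → x ^ n)
  Monic-x^n zero    x = refl
  Monic-x^n (suc n) = (λ x → x ^ n) , Monic-x^n n , 0# , λ x → sym (+-identityʳ _)

  Monic-x*+ : ∀ n {G P} → Monic n G → Poly (suc n) P → Monic (suc n) (λ x → x * G x + P x)
  Monic-x*+ n {G} mG (P′ , pP′ , d , P≈) =
    (λ x → G x + P′ x) , Monic-+-Poly n mG pP′ , d , λ x → trans (+-congˡ (P≈ x))
      (solve 4 (λ x g p d → x :* g :+ (x :* p :+ d) := x :* (g :+ p) :+ d) refl x (G x) (P′ x) d)

  Monic-* : ∀ m n {F G} → Monic m F → Monic n G → Monic (m ℕ.+ n) (λ x → F x * G x)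
  Monic-* zero    n {F} {G} F≈1 mG = Monic-cong n mG (λ x → trans (*-congʳ (F≈1 x)) (*-identityˡ _))
  Monic-* (suc m) n {F} {G} (F′ , mF′ , c , F≈) mG =
    Monic-cong (suc (m ℕ.+ n))
      (Monic-x*+ (m ℕ.+ n) (Monic-* m n mF′ mG) (Poly-≤ (s≤s (ℕ.m≤n+m n m)) (Poly-scale (suc n) c (Monic⇒Poly n mG))))
      (λ x → trans (*-congʳ (F≈ x)) (solve 4 (λ x f c g → (x :* f :+ c) :* g := x :* (f :* g) :+ c :* g) refl x (F′ x) c (G x)))

  Monic-^ : ∀ n {F} k → Monic n F → Monic (n ℕ.* k) (λ x → F x ^ k)
  Monic-^ n {F} zero    mF = ≡.subst (λ d → Monic d (λ x → F x ^ 0)) (≡.sym (ℕ.*-zeroʳ n)) (λ x → refl)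
  Monic-^ n {F} (suc k) mF = ≡.subst (λ d → Monic d (λ x → F x ^ suc k)) (≡.sym (ℕ.*-suc n k))
                                     (Monic-* n (n ℕ.* k) mF (Monic-^ n k mF))

  Monic-x+c : ∀ c → Monic 1 (λ x → x + c)
  Monic-x+c c = (λ _ → 1#) , (λ _ → refl) , c , λ x → +-congʳ (sym (*-identityʳ x))

  Monic-x²+x+c : ∀ c → Monic 2 (λ x → (x * x + x) + c)
  Monic-x²+x+c c = (λ x → x + 1#) , ((λ _ → 1#) , (λ _ → refl) , 1# , λ x → +-congʳ (sym (*-identityʳ x))) , c ,
    λ x → solve 2 (λ x c → (x :* x :+ x) :+ c := x :* (x :+ con 1) :+ c) refl x c

  private
    divide-step : ∀ {Fx Fa Gx Ga x a c h} → Fx ≈ x * Gx + c → Fa ≈ a * Ga + c →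
                  Gx + Ga ≈ (x + a) * h → Fx + Fa ≈ (x + a) * (Gx + a * h)
    divide-step {Fx} {Fa} {Gx} {Ga} {x} {a} {c} {h} Fx≈ Fa≈ G-divided = begin
      Fx + Fa
        ≈⟨ +-cong Fx≈ Fa≈ ⟩
      (x * Gx + c) + (a * Ga + c)
        ≈⟨ solve 5 (λ x a g h c → (x :* g :+ c) :+ (a :* h :+ c) := (x :* g :+ a :* h) :+ (c :+ c)) refl x a Gx Ga c ⟩
      (x * Gx + a * Ga) + (c + c)
        ≈⟨ x+[y+y]≈x _ _ ⟩
      x * Gx + a * Ga
        ≈⟨ x+[y+y]≈x _ _ ⟨
      (x * Gx + a * Ga) + (a * Gx + a * Gx)
        ≈⟨ solve 4 (λ x a g h → (x :* g :+ a :* h) :+ (a :* g :+ a :* g) := (x :* g :+ a :* g) :+ a :* (g :+ h)) refl x a Gx Ga ⟩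
      (x * Gx + a * Gx) + a * (Gx + Ga)
        ≈⟨ +-congˡ (*-congˡ G-divided) ⟩
      (x * Gx + a * Gx) + a * ((x + a) * h)
        ≈⟨ solve 4 (λ x a g h → (x :* g :+ a :* g) :+ a :* ((x :+ a) :* h) := (x :+ a) :* (g :+ a :* h)) refl x a Gx h ⟩
      (x + a) * (Gx + a * h) ∎

  -- In characteristic 2, F x - F a = F x + F a and x - a = x + a.
  Poly-divide : ∀ n {F} → Poly (suc n) F → ∀ a →
                Σ (Carrier → Carrier) λ H → Poly n H × (∀ x → F x + F a ≈ (x + a) * H x)
  Poly-divide zero (G , G≈0 , c , F≈) a =
    (λ x → G x + a * 0#) , Poly-+ zero G≈0 (Poly-scale zero a (λ _ → refl)) ,
    λ x → divide-step (F≈ x) (F≈ a) (trans (+-cong (G≈0 x) (G≈0 a)) (trans (+-identityʳ 0#) (sym (zeroʳ _))))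
  Poly-divide (suc n) (G , pG , c , F≈) a with Poly-divide n pG a
  ... | H , pH , G-divided =
    (λ x → G x + a * H x) , Poly-+ (suc n) pG (Poly-suc n (Poly-scale n a pH)) ,
    λ x → divide-step (F≈ x) (F≈ a) (G-divided x)

  Monic-divide : ∀ n {F} → Monic (suc n) F → ∀ a →
                 Σ (Carrier → Carrier) λ H → Monic n H × (∀ x → F x + F a ≈ (x + a) * H x)
  Monic-divide n (G , mG , c , F≈) a with Poly-divide n (Monic⇒Poly n mG) a
  ... | H , pH , G-divided =
    (λ x → G x + a * H x) , Monic-+-Poly n mG (Poly-scale n a pH) ,
    λ x → divide-step (F≈ x) (F≈ a) (G-divided x)

  IsRoot : (Carrier → Carrier) → Carrier → Set
  IsRoot F x = F x ≈ 0#

  Monic-roots-bound : ∀ n {F xs} → Monic n F → Unique xs → All (IsRoot F) xs → length xs ℕ.≤ n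
  Monic-roots-bound zero    {xs = []}     F≈1 _ _          = z≤n
  Monic-roots-bound zero    {xs = x ∷ xs} F≈1 _ (Fx≈0 ∷ _) = ⊥-elim (1≉0 (trans (sym (F≈1 x)) Fx≈0))
  Monic-roots-bound (suc n) {xs = []}     _   _ _          = z≤n
  Monic-roots-bound (suc n) {F} {a ∷ xs} mF (a≉xs ∷ unique) (Fa≈0 ∷ roots) =
    s≤s (Monic-roots-bound n (proj₁ (proj₂ quotient)) unique (All.zipWith root-of-quotient (a≉xs , roots)))
    where
    quotient = Monic-divide n mF a
    H = proj₁ quotient
    root-of-quotient : ∀ {x} → a ≉ x × F x ≈ 0# → H x ≈ 0#
    root-of-quotient {x} (a≉x , Fx≈0) =
      [ (λ x+a≈0 → ⊥-elim (a≉x (sym (x+y≈0⇒x≈y x+a≈0)))) , id ]′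
      (x*y≈0⇒x≈0⊎y≈0 (trans (sym (proj₂ (proj₂ quotient) x)) (trans (+-cong Fx≈0 Fa≈0) (+-identityʳ 0#))))

  ∃-nonroot : ∀ n {F} {P : Carrier → Set} {xs} → Monic n F → Unique xs → All P xs → n ℕ.< length xs →
              ∃ λ x → P x × F x ≉ 0#
  ∃-nonroot n {F} {xs = xs} mF unique Pxs n<len with All.all? (λ x → F x ≟ 0#) xs
  ... | yes roots = ⊥-elim (ℕ.<⇒≱ n<len (Monic-roots-bound n mF unique roots))
  ... | no ¬roots = _ , All.lookupAny Pxs (All.¬All⇒Any¬ (λ x → F x ≟ 0#) xs ¬roots)

  roots-saturate : ∀ n {F xs b} → Monic n F → Unique xs → All (IsRoot F) xs → n ℕ.≤ length xs →
                   F b ≈ 0# → b ∈ xs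
  roots-saturate n {xs = xs} {b} mF unique roots n≤len Fb≈0 with Any.any? (b ≟_) xs
  ... | yes b∈xs = b∈xs
  ... | no b∉xs  =
    ⊥-elim (ℕ.<⇒≱ (Monic-roots-bound n mF (All.¬Any⇒All¬ xs b∉xs ∷ unique) (Fb≈0 ∷ roots)) n≤len)

  fibre-count : ∀ (φ : Carrier → Carrier) r → (∀ u → Monic r (λ x → φ x + u)) →
                ∀ U {D} → Unique D → All (λ x → φ x ∈ U) D → length D ℕ.≤ length U ℕ.* r
  fibre-count φ r monic []      {[]}    _ _        = z≤n
  fibre-count φ r monic []      {_ ∷ _} _ (() ∷ _)
  fibre-count φ r monic (u ∷ U) {D} unique φD∈u∷U =
    ℕ.≤-trans (length≤filter+reject over-u? D)
              (ℕ.+-mono-≤ fibre-bound (fibre-count φ r monic U (Unique.filter⁺ setoid _ unique) rest-over-U))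
    where
    over-u? = λ x → φ x ≟ u
    fibre-bound : length (filter over-u? D) ℕ.≤ r
    fibre-bound = Monic-roots-bound r (monic u) (Unique.filter⁺ setoid _ unique)
                                    (All.map x≈y⇒x+y≈0 (All.all-filter over-u? D))
    over-U : ∀ {x} → ¬ φ x ≈ u × φ x ∈ u ∷ U → φ x ∈ U
    over-U (φx≉u , here φx≈u) = ⊥-elim (φx≉u φx≈u)
    over-U (_    , there φx∈U) = φx∈U
    rest-over-U : All (λ x → φ x ∈ U) (filter (∁? over-u?) D)
    rest-over-U = All.zipWith over-U (All.all-filter (∁? over-u?) D , All.filter⁺ (∁? over-u?) φD∈u∷U)

  Poly-frobeniusSum : ∀ d {G} .{{_ : NonZero d}} → Monic d G →
                      ∀ j → Poly (d ℕ.* 2 ℕ.^ j) (λ x → frobeniusSum j (G x))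
  Poly-frobeniusSum d mG zero    = Poly-zero (d ℕ.* 1)
  Poly-frobeniusSum d mG (suc j) =
    Poly-+ _ (Poly-≤ (ℕ.<⇒≤ d*2^j<d*2^[1+j]) (Poly-frobeniusSum d mG j))
             (Poly-≤ d*2^j<d*2^[1+j] (Monic⇒Poly _ (Monic-^ d (2 ℕ.^ j) mG)))
    where
    d*2^j<d*2^[1+j] : d ℕ.* 2 ℕ.^ j ℕ.< d ℕ.* 2 ℕ.^ suc j
    d*2^j<d*2^[1+j] = ℕ.*-monoʳ-< d (ℕ.^-monoʳ-< 2 (s≤s (s≤s z≤n)) (ℕ.n<1+n j))

module QuadraticExtension (n : ℕ) (K : FiniteField (2 ℕ.^ suc n ℕ.* 2 ℕ.^ suc n)) where
  open FiniteField K hiding (zero)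
  open FiniteFieldProperties K
  open import Algebra.Properties.CommutativeSemiring.Exp commutativeSemiring
    using (^-congˡ; ^-congʳ; ^-assocʳ; ^-distrib-*)
  open import Relation.Binary.Reasoning.Setoid setoid
  open import Algebra.Solver.Ring.NaturalCoefficients.Default commutativeSemiring
  open import Data.List.Relation.Unary.Unique.Setoid setoid using (Unique)
  import Data.List.Relation.Unary.Unique.Setoid.Properties as Unique
  open import Data.List.Membership.Setoid setoid using (_∈_)
  import Data.List.Membership.Setoid.Properties as Membership

  q : ℕ
  q = 2 ℕ.^ suc n

  open FieldNotions K q public

  instance
    q≢0 : NonZero q
    q≢0 = ℕ.m^n≢0 2 (suc n)

  char2 : Characteristic2 commRing
  char2 = char-2 (∣-trans (m∣m*n (2 ℕ.^ n)) (m∣m*n q))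

  open Characteristic2Properties commRing char2 public
  open PolynomialFunctions K char2 public

  Inₖ-cong : ∀ {x y} → x ≈ y → Inₖ x → Inₖ y
  Inₖ-cong x≈y x∈k = trans (^-congˡ q (sym x≈y)) (trans x∈k x≈y)

  Inₖ-0 : Inₖ 0#
  Inₖ-0 = trans (^-congʳ 0# (≡.sym (ℕ.suc-pred q))) (zeroˡ _)

  Inₖ-1 : Inₖ 1#
  Inₖ-1 = 1^n≈1 commutativeSemiring q

  Inₖ-^ : ∀ {x} m → Inₖ x → Inₖ (x ^ m)
  Inₖ-^ {x} m x∈k = begin
    (x ^ m) ^ q    ≈⟨ ^-assocʳ x m q ⟩
    x ^ (m ℕ.* q)  ≡⟨ ≡.cong (x ^_) (ℕ.*-comm m q) ⟩
    x ^ (q ℕ.* m)  ≈⟨ ^-assocʳ x q m ⟨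
    (x ^ q) ^ m    ≈⟨ ^-congˡ m x∈k ⟩
    x ^ m          ∎

  Inₖ-inverse : ∀ {s} (s≉0 : s ≉ 0#) → Inₖ s → Inₖ (inverse-of s≉0)
  Inₖ-inverse {s} s≉0 s∈k = *-cancelˡ s≉0 (begin
    s * s⁻¹ ^ q       ≈⟨ *-congʳ s∈k ⟨
    s ^ q * s⁻¹ ^ q   ≈⟨ ^-distrib-* s s⁻¹ q ⟨
    (s * s⁻¹) ^ q     ≈⟨ ^-congˡ q (x*x⁻¹≈1 s≉0) ⟩
    1# ^ q            ≈⟨ Inₖ-1 ⟩
    1#                ≈⟨ x*x⁻¹≈1 s≉0 ⟨
    s * s⁻¹           ∎)
    where s⁻¹ = inverse-of s≉0

  Inₖ-Tr : ∀ x → Inₖ (Tr x)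
  Inₖ-Tr x = begin
    (x + x ^ q) ^ q      ≈⟨ frobenius (suc n) x (x ^ q) ⟩
    x ^ q + (x ^ q) ^ q  ≈⟨ +-congˡ (trans (^-assocʳ x q q) (x^card≈x x)) ⟩
    x ^ q + x            ≈⟨ +-comm _ _ ⟩
    x + x ^ q            ∎

  Tr≈0⇒Inₖ : ∀ {x} → Tr x ≈ 0# → Inₖ x
  Tr≈0⇒Inₖ Tr[x]≈0 = sym (x+y≈0⇒x≈y Tr[x]≈0)

  Tr≉0⇒∉k : ∀ {x} → Tr x ≉ 0# → ¬ Inₖ x
  Tr≉0⇒∉k Tr[x]≉0 x∈k = Tr[x]≉0 (x≈y⇒x+y≈0 (sym x∈k))

  Tr-cong : ∀ {x y} → x ≈ y → Tr x ≈ Tr y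
  Tr-cong x≈y = +-cong x≈y (^-congˡ q x≈y)

  Tr-* : ∀ {c} w → Inₖ c → Tr (c * w) ≈ c * Tr w
  Tr-* {c} w c∈k = begin
    c * w + (c * w) ^ q      ≈⟨ +-congˡ (^-distrib-* c w q) ⟩
    c * w + c ^ q * w ^ q    ≈⟨ +-congˡ (*-congʳ c∈k) ⟩
    c * w + c * w ^ q        ≈⟨ distribˡ c w (w ^ q) ⟨
    c * Tr w                 ∎

  subfield : List Carrier
  subfield = filter (λ x → x ^ q ≟ x) elements

  subfield-unique : Unique subfield
  subfield-unique = Unique.filter⁺ setoid _ elements-unique

  subfield⊆k : All Inₖ subfield
  subfield⊆k = All.all-filter (λ x → x ^ q ≟ x) elements

  ∈-subfield : ∀ {x} → Inₖ x → x ∈ subfield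
  ∈-subfield {x} x∈k = Membership.∈-filter⁺ setoid (λ x → x ^ q ≟ x) Inₖ-cong (∈-elements x) x∈k

  2≤q : 2 ℕ.≤ q
  2≤q = ℕ.*-monoʳ-≤ 2 (ℕ.m^n>0 2 n)

  Monic-Tr+c : ∀ c → Monic q (λ x → Tr x + c)
  Monic-Tr+c c = Monic-cong q (Monic-+-Poly q (Monic-x^n q) (Poly-≤ 2≤q (Monic⇒Poly 1 (Monic-x+c c))))
    (λ x → solve 3 (λ x y c → (x :+ y) :+ c := y :+ (x :+ c)) refl x (x ^ q) c)

  -- Tr maps K into k with fibres of size ≤ q, so q * q ≤ |k| * q.
  q≤|subfield| : q ℕ.≤ length subfield
  q≤|subfield| = ℕ.*-cancelʳ-≤ q (length subfield) q
    (≡.subst (ℕ._≤ length subfield ℕ.* q) length-elements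
      (fibre-count Tr q Monic-Tr+c subfield elements-unique
                   (All.universal (λ x → ∈-subfield (Inₖ-Tr x)) elements)))

  q<|elements| : q ℕ.< length elements
  q<|elements| = ≡.subst (q ℕ.<_) (≡.sym length-elements) (ℕ.m<m*n q q 2≤q)

  ∃-Tr≉0 : ∃ λ x → Tr x ≉ 0#
  ∃-Tr≉0 = proj₁ nonroot , λ Tr[x]≈0 → proj₂ (proj₂ nonroot) (trans (+-identityʳ _) Tr[x]≈0)
    where
    nonroot = ∃-nonroot q (Monic-Tr+c 0#) elements-unique (All.universal (λ _ → tt) elements) q<|elements|

  traceOne : Carrier
  traceOne = inverse-of (proj₂ ∃-Tr≉0) * proj₁ ∃-Tr≉0

  Tr-traceOne : Tr traceOne ≈ 1#
  Tr-traceOne = begin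
    Tr (s⁻¹ * x)   ≈⟨ Tr-* x (Inₖ-inverse Tr[x]≉0 (Inₖ-Tr x)) ⟩
    s⁻¹ * Tr x     ≈⟨ *-comm _ _ ⟩
    Tr x * s⁻¹     ≈⟨ x*x⁻¹≈1 Tr[x]≉0 ⟩
    1#             ∎
    where
    x = proj₁ ∃-Tr≉0
    Tr[x]≉0 = proj₂ ∃-Tr≉0
    s⁻¹ = inverse-of Tr[x]≉0

  -- For w of trace 1, w ^ q = 1 + w, so the norm w ^ (q + 1) is N w.
  N : Carrier → Carrier
  N w = w + w * w

  module TraceOne {w : Carrier} (Tr[w]≈1 : Tr w ≈ 1#) where
    w^q≈1+w : w ^ q ≈ 1# + w
    w^q≈1+w = x+y≈0⇒x≈y (begin
      w ^ q + (1# + w)   ≈⟨ solve 2 (λ w y → y :+ (con 1 :+ w) := (w :+ y) :+ con 1) refl w (w ^ q) ⟩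
      Tr w + 1#          ≈⟨ +-congʳ Tr[w]≈1 ⟩
      1# + 1#            ≈⟨ char2 ⟩
      0#                 ∎)

    w^[1+q]≈N[w] : w ^ suc q ≈ N w
    w^[1+q]≈N[w] = begin
      w * w ^ q          ≈⟨ *-congˡ w^q≈1+w ⟩
      w * (1# + w)       ≈⟨ solve 1 (λ w → w :* (con 1 :+ w) := w :+ w :* w) refl w ⟩
      N w                ∎

    Inₖ-N : Inₖ (N w)
    Inₖ-N = begin
      (w + w * w) ^ q
        ≈⟨ frobenius (suc n) w (w * w) ⟩
      w ^ q + (w * w) ^ q
        ≈⟨ +-congˡ (^-distrib-* w w q) ⟩
      w ^ q + w ^ q * w ^ q
        ≈⟨ +-cong w^q≈1+w (*-cong w^q≈1+w w^q≈1+w) ⟩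
      (1# + w) + (1# + w) * (1# + w)
        ≈⟨ solve 1 (λ w → (con 1 :+ w) :+ (con 1 :+ w) :* (con 1 :+ w) := (w :+ w :* w) :+ ((con 1 :+ con 1) :+ (w :+ w))) refl w ⟩
      N w + ((1# + 1#) + (w + w))
        ≈⟨ +-congˡ (+-congʳ char2) ⟩
      N w + (0# + (w + w))
        ≈⟨ +-congˡ (+-identityˡ _) ⟩
      N w + (w + w)
        ≈⟨ x+[y+y]≈x _ _ ⟩
      N w ∎

    w≉0 : w ≉ 0#
    w≉0 w≈0 = 1≉0 (trans (sym Tr[w]≈1) (trans (Tr-cong w≈0) (x≈y⇒x+y≈0 (sym Inₖ-0))))

    N≉0 : N w ≉ 0#
    N≉0 N[w]≈0 = ^-≉0 (suc q) w≉0 (trans w^[1+q]≈N[w] N[w]≈0)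

    Tr[w³]≈1+N[w] : Tr (w ^ 3) ≈ 1# + N w
    Tr[w³]≈1+N[w] = begin
      w ^ 3 + (w ^ 3) ^ q
        ≈⟨ +-congˡ (^-assocʳ w 3 q) ⟩
      w ^ 3 + w ^ (3 ℕ.* q)
        ≡⟨ ≡.cong (λ m → w ^ 3 + w ^ m) (ℕ.*-comm 3 q) ⟩
      w ^ 3 + w ^ (q ℕ.* 3)
        ≈⟨ +-congˡ (^-assocʳ w q 3) ⟨
      w ^ 3 + (w ^ q) ^ 3
        ≈⟨ +-congˡ (^-congˡ 3 w^q≈1+w) ⟩
      w ^ 3 + (1# + w) ^ 3
        ≈⟨ solve 1 (λ w → w :* (w :* (w :* con 1)) :+ (con 1 :+ w) :* ((con 1 :+ w) :* ((con 1 :+ w) :* con 1)) := (con 1 :+ (w :+ w :* w)) :+ ((w :+ w) :+ ((w :* w :+ w :* w) :+ (w :* (w :* w) :+ w :* (w :* w))))) refl w ⟩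
      (1# + N w) + ((w + w) + ((w * w + w * w) + (w * (w * w) + w * (w * w))))
                                 ≈⟨ +-congˡ (+-cong (x+x≈0 w) (+-cong (x+x≈0 _) (x+x≈0 _))) ⟩
      (1# + N w) + (0# + (0# + 0#)) ≈⟨ +-congˡ (trans (+-identityˡ _) (+-identityˡ 0#)) ⟩
      (1# + N w) + 0#            ≈⟨ +-identityʳ _ ⟩
      1# + N w                   ∎

  Tr[traceOne+a]≈1 : ∀ {a} → Inₖ a → Tr (traceOne + a) ≈ 1#
  Tr[traceOne+a]≈1 {a} a∈k = begin
    (v + a) + (v + a) ^ q
      ≈⟨ +-congˡ (frobenius (suc n) v a) ⟩
    (v + a) + (v ^ q + a ^ q)
      ≈⟨ +-congˡ (+-congˡ a∈k) ⟩
    (v + a) + (v ^ q + a)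
      ≈⟨ solve 3 (λ v a y → (v :+ a) :+ (y :+ a) := (v :+ y) :+ (a :+ a)) refl v a (v ^ q) ⟩
    Tr v + (a + a)
      ≈⟨ x+[y+y]≈x _ _ ⟩
    Tr v
      ≈⟨ Tr-traceOne ⟩
    1# ∎
    where v = traceOne

  N[traceOne+a] : ∀ a → N (traceOne + a) ≈ (a * a + a) + N traceOne
  N[traceOne+a] a = begin
    (v + a) + (v + a) * (v + a)
      ≈⟨ solve 2 (λ v a → (v :+ a) :+ (v :+ a) :* (v :+ a) := ((a :* a :+ a) :+ (v :+ v :* v)) :+ (v :* a :+ v :* a)) refl v a ⟩
    ((a * a + a) + N v) + (v * a + v * a)
      ≈⟨ x+[y+y]≈x _ _ ⟩
    (a * a + a) + N v ∎
    where v = traceOne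

  absTr : Carrier → Carrier
  absTr = frobeniusSum (suc n)

  absTr-idem : ∀ {u} → Inₖ u → absTr u ^ 2 ≈ absTr u
  absTr-idem {u} u∈k = begin
    absTr u ^ 2                       ≈⟨ square-of-frobeniusSum (suc n) u ⟩
    (absTr u + u ^ q) + u             ≈⟨ +-assoc _ _ _ ⟩
    absTr u + (u ^ q + u)             ≈⟨ +-congˡ (+-congʳ u∈k) ⟩
    absTr u + (u + u)                 ≈⟨ x+[y+y]≈x _ _ ⟩
    absTr u                           ∎

  absTr≉0⇒absTr≈1 : ∀ {u} → Inₖ u → absTr u ≉ 0# → absTr u ≈ 1#
  absTr≉0⇒absTr≈1 {u} u∈k T[u]≉0 = [ ⊥-elim ∘ T[u]≉0 , x+y≈0⇒x≈y ]′ (x*y≈0⇒x≈0⊎y≈0 (begin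
    absTr u * (absTr u + 1#)
      ≈⟨ solve 1 (λ t → t :* (t :+ con 1) := t :* (t :* con 1) :+ t) refl (absTr u) ⟩
    absTr u ^ 2 + absTr u
      ≈⟨ +-congʳ (absTr-idem u∈k) ⟩
    absTr u + absTr u
      ≈⟨ x+x≈0 _ ⟩
    0# ∎))

  absTr[a²+a]≈0 : ∀ {a} → Inₖ a → absTr (a * a + a) ≈ 0#
  absTr[a²+a]≈0 {a} a∈k = begin
    absTr (a * a + a)        ≈⟨ frobeniusSum-+ (suc n) (a * a) a ⟩
    absTr (a * a) + absTr a  ≈⟨ +-congʳ (frobeniusSum-of-square (suc n) a) ⟩
    absTr a ^ 2 + absTr a    ≈⟨ +-congʳ (absTr-idem a∈k) ⟩
    absTr a + absTr a        ≈⟨ x+x≈0 _ ⟩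
    0#                       ∎

  Monic-absTr : Monic (2 ℕ.^ n) absTr
  Monic-absTr = Monic-cong (2 ℕ.^ n)
    (Monic-+-Poly (2 ℕ.^ n) (Monic-x^n (2 ℕ.^ n))
      (Poly-≤ (ℕ.≤-reflexive (ℕ.*-identityˡ _)) (Poly-frobeniusSum 1 (Monic-x+c 0#) n)))
    (λ u → trans (+-comm _ _) (+-congˡ (frobeniusSum-cong n (sym (+-identityʳ u)))))

  -- Additive Hilbert 90: the image of a ↦ a² + a on k has at least q / 2 elements (fibres have at
  -- most two), all of them roots of the monic absTr of degree q / 2, so it contains every root.
  hilbert90 : ∀ {b} → absTr b ≈ 0# → ∃ λ a → Inₖ a × a * a + a ≈ b
  hilbert90 {b} T[b]≈0 = _ , All.lookupAny subfield⊆k b∈image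
    where
    InImage : Carrier → Set
    InImage u = Any (λ a → a * a + a ≈ u) subfield
    InImage? : ∀ u → Dec (InImage u)
    InImage? u = Any.any? (λ a → a * a + a ≟ u) subfield
    InImage-resp : ∀ {u v} → u ≈ v → InImage u → InImage v
    InImage-resp u≈v = Any.map (λ a²+a≈u → trans a²+a≈u u≈v)
    image : List Carrier
    image = filter InImage? elements
    ∈-image : ∀ {a} → Inₖ a → a * a + a ∈ image
    ∈-image a∈k = Membership.∈-filter⁺ setoid InImage? InImage-resp (∈-elements _)
      (Any.map (λ a≈x → sym (+-cong (*-cong a≈x a≈x) a≈x)) (∈-subfield a∈k))
    root : ∀ {u} → InImage u → absTr u ≈ 0#
    root u∈image = trans (frobeniusSum-cong (suc n) (sym (proj₂ a∈k×a²+a≈u))) (absTr[a²+a]≈0 (proj₁ a∈k×a²+a≈u))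
      where a∈k×a²+a≈u = All.lookupAny subfield⊆k u∈image
    2^n≤|image| : 2 ℕ.^ n ℕ.≤ length image
    2^n≤|image| = ℕ.*-cancelʳ-≤ (2 ℕ.^ n) (length image) 2
      (ℕ.≤-trans (ℕ.≤-reflexive (ℕ.*-comm (2 ℕ.^ n) 2)) (ℕ.≤-trans q≤|subfield|
        (fibre-count (λ a → a * a + a) 2 Monic-x²+x+c image subfield-unique (All.map ∈-image subfield⊆k))))
    b∈image : InImage b
    b∈image = proj₂ (Membership.∈-filter⁻ setoid InImage? InImage-resp {xs = elements}
      (roots-saturate (2 ℕ.^ n) Monic-absTr (Unique.filter⁺ setoid _ elements-unique)
                      (All.map root (All.all-filter InImage? elements)) 2^n≤|image| T[b]≈0))

module Cubes (n : ℕ) (K : FiniteField (2 ℕ.^ suc n ℕ.* 2 ℕ.^ suc n))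
             (f : ℕ) (q≡1+3f : 2 ℕ.^ suc n ≡ suc (3 ℕ.* f)) where
  open FiniteField K hiding (zero)
  open FiniteFieldProperties K
  open QuadraticExtension n K
  open import Algebra.Properties.CommutativeSemiring.Exp commutativeSemiring
    using (^-congˡ; ^-assocʳ; ^-distrib-*)
  open import Relation.Binary.Reasoning.Setoid setoid
  open import Algebra.Solver.Ring.NaturalCoefficients.Default commutativeSemiring

  e : ℕ
  e = suc q ℕ.* f

  q*q∸1≡3e : ℕ.pred (q ℕ.* q) ≡ 3 ℕ.* e
  q*q∸1≡3e = ≡.subst (λ m → ℕ.pred (m ℕ.* m) ≡ 3 ℕ.* (suc m ℕ.* f)) (≡.sym q≡1+3f) ([1+3f]²∸1≡3*[2+3f]*f f)

  [1+f]*3≡2+q : suc f ℕ.* 3 ≡ suc (suc q)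
  [1+f]*3≡2+q = ≡.trans (ℕ.*-comm (suc f) 3) (≡.trans (ℕ.*-suc 3 f) (≡.cong (λ m → suc (suc m)) (≡.sym q≡1+3f)))

  instance
    f≢0 : NonZero f
    f≢0 = ℕ.≢-nonZero (λ f≡0 → ℕ.<-irrefl (≡.sym (≡.trans q≡1+3f (≡.cong (λ g → suc (3 ℕ.* g)) f≡0))) 2≤q)

  Inₖ⇒^[3f]≈1 : ∀ {t} → Inₖ t → t ≉ 0# → t ^ (3 ℕ.* f) ≈ 1#
  Inₖ⇒^[3f]≈1 {t} t∈k t≉0 = *-cancelˡ t≉0 (begin
    t * t ^ (3 ℕ.* f)  ≡⟨ ≡.cong (t ^_) q≡1+3f ⟨
    t ^ q              ≈⟨ t∈k ⟩
    t                  ≈⟨ *-identityʳ t ⟨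
    t * 1#             ∎)

  Cubeₖ⇒^f≈1 : ∀ {t} → Cubeₖ t → t ^ f ≈ 1#
  Cubeₖ⇒^f≈1 {t} (z , z∈k , z≉0 , z³≈t) = begin
    t ^ f          ≈⟨ ^-congˡ f z³≈t ⟨
    (z ^ 3) ^ f    ≈⟨ ^-assocʳ z 3 f ⟩
    z ^ (3 ℕ.* f)  ≈⟨ Inₖ⇒^[3f]≈1 z∈k z≉0 ⟩
    1#             ∎

  ^f≉1⇒NonCubeₖ : ∀ {t} → Inₖ t → t ≉ 0# → t ^ f ≉ 1# → NonCubeₖ t
  ^f≉1⇒NonCubeₖ t∈k t≉0 t^f≉1 = t∈k , t≉0 , λ t-cube → t^f≉1 (Cubeₖ⇒^f≈1 t-cube)

  CubeK₂⇒^e≈1 : ∀ {x} → CubeK₂ x → x ^ e ≈ 1#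
  CubeK₂⇒^e≈1 {x} (y , y≉0 , y³≈x) = begin
    x ^ e                  ≈⟨ ^-congˡ e y³≈x ⟨
    (y ^ 3) ^ e            ≈⟨ ^-assocʳ y 3 e ⟩
    y ^ (3 ℕ.* e)          ≡⟨ ≡.cong (y ^_) q*q∸1≡3e ⟨
    y ^ ℕ.pred (q ℕ.* q)   ≈⟨ fermat y≉0 ⟩
    1#                     ∎

  ^e≉1⇒¬CubeK₂ : ∀ {x} → x ^ e ≉ 1# → ¬ CubeK₂ x
  ^e≉1⇒¬CubeK₂ x^e≉1 x-cube = x^e≉1 (CubeK₂⇒^e≈1 x-cube)

  Tr≈1⇒w^e≈N^f : ∀ {w} → Tr w ≈ 1# → w ^ e ≈ N w ^ f
  Tr≈1⇒w^e≈N^f {w} Tr[w]≈1 = trans (sym (^-assocʳ w (suc q) f)) (^-congˡ f (TraceOne.w^[1+q]≈N[w] Tr[w]≈1))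

  Tr≈1⇒∉k : ∀ {w} → Tr w ≈ 1# → ¬ Inₖ w
  Tr≈1⇒∉k Tr[w]≈1 = Tr≉0⇒∉k (λ Tr[w]≈0 → 1≉0 (trans (sym Tr[w]≈1) Tr[w]≈0))

  2f<q : 2 ℕ.* f ℕ.< q
  2f<q = ≡.subst (2 ℕ.* f ℕ.<_) (≡.sym q≡1+3f) (s≤s (ℕ.*-monoˡ-≤ f (ℕ.n≤1+n 2)))

  1+f<q : suc f ℕ.< q
  1+f<q = ≡.subst (suc f ℕ.<_) (≡.sym q≡1+3f) (s≤s (≡.subst (f ℕ.<_) (ℕ.*-comm f 3) (ℕ.m<m*n f 3 (s≤s (s≤s z≤n)))))

  -- On k, a ↦ N (traceOne + a) ^ f is a polynomial of degree 2f < q, so it misses c somewhere on k.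
  ∃-Tr≈1∧N^f≉ : ∀ c → ∃ λ w → Tr w ≈ 1# × N w ^ f ≉ c
  ∃-Tr≈1∧N^f≉ c = traceOne + a , Tr[traceOne+a]≈1 a∈k ,
    λ N^f≈c → F[a]+c≉0 (x≈y⇒x+y≈0 (trans (^-congˡ f (sym (N[traceOne+a] a))) N^f≈c))
    where
    nonroot = ∃-nonroot (2 ℕ.* f) (Monic-+-const (2 ℕ.* f) c {{ℕ.m*n≢0 2 f}} (Monic-^ 2 f (Monic-x²+x+c (N traceOne))))
                        subfield-unique subfield⊆k (ℕ.<-≤-trans 2f<q q≤|subfield|)
    a = proj₁ nonroot
    a∈k = proj₁ (proj₂ nonroot)
    F[a]+c≉0 = proj₂ (proj₂ nonroot)

  ∃-^f≉1 : ∃ λ t → Inₖ t × t ≉ 0# × t ^ f ≉ 1#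
  ∃-^f≉1 = t , t∈k , t≉0 , t^f≉1
    where
    Monic-x^[1+f]+x : Monic (suc f) (λ x → x ^ suc f + (x + 0#))
    Monic-x^[1+f]+x = Monic-+-Poly (suc f) (Monic-x^n (suc f)) (Poly-≤ (s≤s (ℕ.>-nonZero⁻¹ f)) (Monic⇒Poly 1 (Monic-x+c 0#)))
    nonroot = ∃-nonroot (suc f) Monic-x^[1+f]+x subfield-unique subfield⊆k (ℕ.<-≤-trans 1+f<q q≤|subfield|)
    t = proj₁ nonroot
    t∈k = proj₁ (proj₂ nonroot)
    t^[1+f]+[t+0]≉0 = proj₂ (proj₂ nonroot)
    t≉0 : t ≉ 0#
    t≉0 t≈0 = t^[1+f]+[t+0]≉0 (begin
      t * t ^ f + (t + 0#)   ≈⟨ +-cong (*-congʳ t≈0) (trans (+-identityʳ t) t≈0) ⟩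
      0# * t ^ f + 0#        ≈⟨ trans (+-identityʳ _) (zeroˡ _) ⟩
      0#                     ∎)
    t^f≉1 : t ^ f ≉ 1#
    t^f≉1 t^f≈1 = t^[1+f]+[t+0]≉0 (begin
      t * t ^ f + (t + 0#)   ≈⟨ +-cong (trans (*-congˡ t^f≈1) (*-identityʳ t)) (+-identityʳ t) ⟩
      t + t                  ≈⟨ x+x≈0 t ⟩
      0#                     ∎)

  Tr[[w^[1+f]]³]≈N : ∀ {w} → Tr w ≈ 1# → Tr ((w ^ suc f) ^ 3) ≈ N w
  Tr[[w^[1+f]]³]≈N {w} Tr[w]≈1 = begin
    Tr ((w ^ suc f) ^ 3)       ≈⟨ Tr-cong w^[[1+f]*3]≈N*w ⟩
    Tr (N w * w)               ≈⟨ Tr-* w (TraceOne.Inₖ-N Tr[w]≈1) ⟩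
    N w * Tr w                 ≈⟨ *-congˡ Tr[w]≈1 ⟩
    N w * 1#                   ≈⟨ *-identityʳ _ ⟩
    N w                        ∎
    where
    w^[[1+f]*3]≈N*w : (w ^ suc f) ^ 3 ≈ N w * w
    w^[[1+f]*3]≈N*w = begin
      (w ^ suc f) ^ 3          ≈⟨ ^-assocʳ w (suc f) 3 ⟩
      w ^ (suc f ℕ.* 3)        ≡⟨ ≡.cong (w ^_) [1+f]*3≡2+q ⟩
      w * w ^ suc q            ≈⟨ *-congˡ (TraceOne.w^[1+q]≈N[w] Tr[w]≈1) ⟩
      w * N w                  ≈⟨ *-comm _ _ ⟩
      N w * w                  ∎

  [t*w]^e≈1⇒N^f≈t^f : ∀ {t w} → Inₖ t → t ≉ 0# → Tr w ≈ 1# → (t * w) ^ e ≈ 1# → N w ^ f ≈ t ^ f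
  [t*w]^e≈1⇒N^f≈t^f {t} {w} t∈k t≉0 Tr[w]≈1 [tw]^e≈1 = begin
    N w ^ f
      ≈⟨ *-identityˡ _ ⟨
    1# * N w ^ f
      ≈⟨ *-congʳ (Inₖ⇒^[3f]≈1 t∈k t≉0) ⟨
    t ^ (3 ℕ.* f) * N w ^ f
      ≈⟨ *-congʳ (^-assocʳ t 3 f) ⟨
    (t ^ 3) ^ f * N w ^ f
      ≈⟨ *-congʳ (^-congˡ f (solve 1 (λ t → t :* (t :* (t :* con 1)) := t :* (t :* t)) refl t)) ⟩
    (t * (t * t)) ^ f * N w ^ f
      ≈⟨ *-congʳ (^-distrib-* t (t * t) f) ⟩
    (t ^ f * (t * t) ^ f) * N w ^ f
      ≈⟨ *-assoc _ _ _ ⟩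
    t ^ f * ((t * t) ^ f * N w ^ f)
      ≈⟨ *-congˡ [t*t]^f*N^f≈1 ⟩
    t ^ f * 1#
      ≈⟨ *-identityʳ _ ⟩
    t ^ f ∎
    where
    t^e≈[t*t]^f : t ^ e ≈ (t * t) ^ f
    t^e≈[t*t]^f = trans (sym (^-assocʳ t (suc q) f)) (^-congˡ f (*-congˡ t∈k))
    [t*t]^f*N^f≈1 : (t * t) ^ f * N w ^ f ≈ 1#
    [t*t]^f*N^f≈1 = begin
      (t * t) ^ f * N w ^ f    ≈⟨ *-cong t^e≈[t*t]^f (Tr≈1⇒w^e≈N^f Tr[w]≈1) ⟨
      t ^ e * w ^ e            ≈⟨ ^-distrib-* t w e ⟨
      (t * w) ^ e              ≈⟨ [tw]^e≈1 ⟩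
      1#                       ∎

  noncube-with-cube-trace : ∃ λ x → NonCubeK₂ x × ¬ Inₖ x × Cubeₖ (Tr x)
  noncube-with-cube-trace =
    let (w , Tr[w]≈1 , N^f≉1) = ∃-Tr≈1∧N^f≉ 1# in
    w , (TraceOne.w≉0 Tr[w]≈1 , ^e≉1⇒¬CubeK₂ (λ w^e≈1 → N^f≉1 (trans (sym (Tr≈1⇒w^e≈N^f Tr[w]≈1)) w^e≈1))) ,
    Tr≈1⇒∉k Tr[w]≈1 , (1# , Inₖ-1 , 1≉0 , trans (1^n≈1 commutativeSemiring 3) (sym Tr[w]≈1))

  cube-with-noncube-trace : ∃ λ x → CubeK₂ x × ¬ Inₖ x × NonCubeₖ (Tr x)
  cube-with-noncube-trace =
    let (w , Tr[w]≈1 , N^f≉1) = ∃-Tr≈1∧N^f≉ 1#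
        Tr[x]≈N = Tr[[w^[1+f]]³]≈N Tr[w]≈1
        Tr[x]≉0 = λ Tr[x]≈0 → TraceOne.N≉0 Tr[w]≈1 (trans (sym Tr[x]≈N) Tr[x]≈0) in
    (w ^ suc f) ^ 3 , (w ^ suc f , ^-≉0 (suc f) (TraceOne.w≉0 Tr[w]≈1) , refl) , Tr≉0⇒∉k Tr[x]≉0 ,
    ^f≉1⇒NonCubeₖ (Inₖ-Tr _) Tr[x]≉0 (λ Tr[x]^f≈1 → N^f≉1 (trans (^-congˡ f (sym Tr[x]≈N)) Tr[x]^f≈1))

  noncube-with-noncube-trace : ∃ λ x → NonCubeK₂ x × ¬ Inₖ x × NonCubeₖ (Tr x)
  noncube-with-noncube-trace =
    let (t , t∈k , t≉0 , t^f≉1) = ∃-^f≉1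
        (w , Tr[w]≈1 , N^f≉t^f) = ∃-Tr≈1∧N^f≉ (t ^ f)
        Tr[tw]≈t = trans (Tr-* w t∈k) (trans (*-congˡ Tr[w]≈1) (*-identityʳ t))
        Tr[tw]≉0 = λ Tr[tw]≈0 → t≉0 (trans (sym Tr[tw]≈t) Tr[tw]≈0) in
    t * w , (*-≉0 t≉0 (TraceOne.w≉0 Tr[w]≈1) , ^e≉1⇒¬CubeK₂ (N^f≉t^f ∘ [t*w]^e≈1⇒N^f≈t^f t∈k t≉0 Tr[w]≈1)) ,
    Tr≉0⇒∉k Tr[tw]≉0 ,
    ^f≉1⇒NonCubeₖ (Inₖ-Tr _) Tr[tw]≉0 (λ Tr[tw]^f≈1 → t^f≉1 (trans (^-congˡ f (sym Tr[tw]≈t)) Tr[tw]^f≈1))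

  cubes-have-noncube-trace : f ≡ 1 → ∀ x → CubeK₂ x → ¬ Inₖ x → NonCubeₖ (Tr x)
  cubes-have-noncube-trace f≡1 x x-cube x∉k = Inₖ-Tr x , Tr[x]≉0 , Tr[x]-noncube
    where
    Tr[x]≉0 : Tr x ≉ 0#
    Tr[x]≉0 Tr[x]≈0 = x∉k (Tr≈0⇒Inₖ Tr[x]≈0)
    q≡4 : q ≡ 4
    q≡4 = ≡.trans q≡1+3f (≡.cong (λ g → suc (3 ℕ.* g)) f≡1)
    x⁵≈1 : x ^ 5 ≈ 1#
    x⁵≈1 = ≡.subst (λ m → x ^ m ≈ 1#) (≡.cong₂ (λ a b → suc a ℕ.* b) q≡4 f≡1) (CubeK₂⇒^e≈1 x-cube)
    Tr[x]-noncube : ¬ Cubeₖ (Tr x)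
    Tr[x]-noncube Tr[x]-cube = x∉k (Inₖ-cong (sym (x⁵≈1⇒x+x⁴≈1⇒x≈1 x x⁵≈1 x+x⁴≈1)) Inₖ-1)
      where
      x+x⁴≈1 : x + x ^ 4 ≈ 1#
      x+x⁴≈1 = trans (sym (*-identityʳ _))
        (≡.subst (λ m → (x + x ^ m) * 1# ≈ 1#) q≡4 (≡.subst (λ g → Tr x ^ g ≈ 1#) f≡1 (Cubeₖ⇒^f≈1 Tr[x]-cube)))

module CubeWithCubeTrace (j : ℕ) (K : FiniteField (2 ℕ.^ suc (suc j) ℕ.* 2 ℕ.^ suc (suc j))) where
  open FiniteField K hiding (zero)
  open FiniteFieldProperties K
  open QuadraticExtension (suc j) K
  open import Algebra.Properties.CommutativeSemiring.Exp commutativeSemiring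
    using (^-congˡ; ^-assocʳ; ^-homo-*)
  open import Relation.Binary.Reasoning.Setoid setoid
  open import Algebra.Solver.Ring.NaturalCoefficients.Default commutativeSemiring

  -- On k the top term (z³)^(2^(j+1)) = z^(q + 2^(j+1)) of absTr (z³) has degree only 2^(j+1) + 1.
  absTr-of-cube-on-k : Carrier → Carrier
  absTr-of-cube-on-k z = frobeniusSum (suc j) (z ^ 3) + z ^ suc (2 ℕ.^ suc j)

  absTr-of-cube-on-k≈absTr[z³] : ∀ {z} → Inₖ z → absTr-of-cube-on-k z ≈ absTr (z ^ 3)
  absTr-of-cube-on-k≈absTr[z³] {z} z∈k = +-congˡ (begin
    z * z ^ 2^[1+j]                ≈⟨ *-congʳ z∈k ⟨
    z ^ q * z ^ 2^[1+j]            ≈⟨ ^-homo-* z q 2^[1+j] ⟨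
    z ^ (q ℕ.+ 2^[1+j])            ≡⟨ ≡.cong (z ^_) (3*m≡2*m+m 2^[1+j]) ⟨
    z ^ (3 ℕ.* 2^[1+j])            ≈⟨ ^-assocʳ z 3 2^[1+j] ⟨
    (z ^ 3) ^ 2^[1+j]              ∎)
    where 2^[1+j] = 2 ℕ.^ suc j

  Monic-absTr-of-cube-on-k : 1 ℕ.≤ j → Monic (3 ℕ.* 2 ℕ.^ j) absTr-of-cube-on-k
  Monic-absTr-of-cube-on-k 1≤j = Monic-cong (3 ℕ.* 2 ℕ.^ j)
    (Monic-+-Poly (3 ℕ.* 2 ℕ.^ j) (Monic-^ 3 (2 ℕ.^ j) (Monic-x^n 3))
      (Poly-+ (3 ℕ.* 2 ℕ.^ j) (Poly-frobeniusSum 3 (Monic-x^n 3) j)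
        (Poly-≤ 2+2^[1+j]≤3*2^j (Monic⇒Poly _ (Monic-x^n (suc (2 ℕ.^ suc j)))))))
    (λ z → solve 3 (λ a b c → (a :+ b) :+ c := b :+ (a :+ c)) refl
                   (frobeniusSum j (z ^ 3)) ((z ^ 3) ^ (2 ℕ.^ j)) (z ^ suc (2 ℕ.^ suc j)))
    where
    2+2^[1+j]≤3*2^j : suc (suc (2 ℕ.^ suc j)) ℕ.≤ 3 ℕ.* 2 ℕ.^ j
    2+2^[1+j]≤3*2^j = ℕ.≤-trans (ℕ.+-monoˡ-≤ (2 ℕ.* 2 ℕ.^ j) (ℕ.^-monoʳ-≤ 2 1≤j))
      (ℕ.≤-reflexive (≡.trans (ℕ.+-comm (2 ℕ.^ j) (2 ℕ.* 2 ℕ.^ j)) (≡.sym (3*m≡2*m+m (2 ℕ.^ j)))))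

  3*2^j<q : 3 ℕ.* 2 ℕ.^ j ℕ.< q
  3*2^j<q = ℕ.<-≤-trans (ℕ.m<m+n (3 ℕ.* 2 ℕ.^ j) (ℕ.m^n>0 2 j)) (ℕ.≤-reflexive (3*m+m≡2*[2*m] (2 ℕ.^ j)))

  ∃-absTr[z³]≈absTr : 1 ℕ.≤ j → 2 ∣ suc (suc j) → ∀ {c} → Inₖ c →
                      ∃ λ z → Inₖ z × z ≉ 0# × absTr (z ^ 3) ≈ absTr c
  ∃-absTr[z³]≈absTr 1≤j 2∣[2+j] {c} c∈k = choose (absTr c ≟ 0#)
    where
    choose : Dec (absTr c ≈ 0#) → ∃ λ z → Inₖ z × z ≉ 0# × absTr (z ^ 3) ≈ absTr c
    choose (yes T[c]≈0) = 1# , Inₖ-1 , 1≉0 ,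
      trans (frobeniusSum-cong (suc (suc j)) (1^n≈1 commutativeSemiring 3)) (trans (frobeniusSum-1 2∣[2+j]) (sym T[c]≈0))
    choose (no T[c]≉0) =
      z , z∈k , z≉0 , trans (absTr≉0⇒absTr≈1 (Inₖ-^ 3 z∈k) T[z³]≉0) (sym (absTr≉0⇒absTr≈1 c∈k T[c]≉0))
      where
      nonroot = ∃-nonroot (3 ℕ.* 2 ℕ.^ j) (Monic-absTr-of-cube-on-k 1≤j) subfield-unique subfield⊆k
                          (ℕ.<-≤-trans 3*2^j<q q≤|subfield|)
      z = proj₁ nonroot
      z∈k = proj₁ (proj₂ nonroot)
      T[z³]≉0 : absTr (z ^ 3) ≉ 0#
      T[z³]≉0 T[z³]≈0 = proj₂ (proj₂ nonroot) (trans (absTr-of-cube-on-k≈absTr[z³] z∈k) T[z³]≈0)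
      z≉0 : z ≉ 0#
      z≉0 z≈0 = T[z³]≉0 (trans (frobeniusSum-cong (suc (suc j)) (trans (^-congˡ 3 z≈0) (zeroˡ _)))
                               (frobeniusSum-0 (suc (suc j))))

  -- With N (traceOne + a) = (a² + a) + N traceOne and Tr (w³) = 1 + N w for Tr w = 1, the trace of
  -- (traceOne + a)³ is z³ as soon as a² + a = z³ + (1 + N traceOne), which Hilbert 90 solves.
  cube-with-cube-trace : 1 ℕ.≤ j → 2 ∣ suc (suc j) → ∃ λ x → CubeK₂ x × ¬ Inₖ x × Cubeₖ (Tr x)
  cube-with-cube-trace 1≤j 2∣[2+j] =
    w ^ 3 , (w , TraceOne.w≉0 Tr[w]≈1 , refl) ,
    Tr≉0⇒∉k (λ Tr[w³]≈0 → ^-≉0 3 z≉0 (trans (sym Tr[w³]≈z³) Tr[w³]≈0)) , (z , z∈k , z≉0 , sym Tr[w³]≈z³)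
    where
    v = traceOne
    chosen = ∃-absTr[z³]≈absTr 1≤j 2∣[2+j] (TraceOne.Inₖ-N Tr-traceOne)
    z = proj₁ chosen
    z∈k = proj₁ (proj₂ chosen)
    z≉0 = proj₁ (proj₂ (proj₂ chosen))
    b = z ^ 3 + (1# + N v)
    absTr[b]≈0 : absTr b ≈ 0#
    absTr[b]≈0 = begin
      absTr (z ^ 3 + (1# + N v))
        ≈⟨ frobeniusSum-+ (suc (suc j)) (z ^ 3) (1# + N v) ⟩
      absTr (z ^ 3) + absTr (1# + N v)
        ≈⟨ +-cong (proj₂ (proj₂ (proj₂ chosen))) (frobeniusSum-+ (suc (suc j)) 1# (N v)) ⟩
      absTr (N v) + (absTr 1# + absTr (N v))
        ≈⟨ +-congˡ (+-congʳ (frobeniusSum-1 2∣[2+j])) ⟩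
      absTr (N v) + (0# + absTr (N v))
        ≈⟨ +-congˡ (+-identityˡ _) ⟩
      absTr (N v) + absTr (N v)
        ≈⟨ x+x≈0 _ ⟩
      0# ∎
    solution = hilbert90 absTr[b]≈0
    a = proj₁ solution
    w = v + a
    Tr[w]≈1 = Tr[traceOne+a]≈1 (proj₁ (proj₂ solution))
    Tr[w³]≈z³ : Tr (w ^ 3) ≈ z ^ 3
    Tr[w³]≈z³ = begin
      Tr (w ^ 3)
        ≈⟨ TraceOne.Tr[w³]≈1+N[w] Tr[w]≈1 ⟩
      1# + N w
        ≈⟨ +-congˡ (trans (N[traceOne+a] a) (+-congʳ (proj₂ (proj₂ solution)))) ⟩
      1# + ((z ^ 3 + (1# + N v)) + N v)
        ≈⟨ solve 3 (λ y o n → o :+ ((y :+ (o :+ n)) :+ n) := y :+ ((o :+ o) :+ (n :+ n))) refl (z ^ 3) 1# (N v) ⟩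
      z ^ 3 + ((1# + 1#) + (N v + N v))
        ≈⟨ +-congˡ (+-cong char2 (x+x≈0 _)) ⟩
      z ^ 3 + (0# + 0#)
        ≈⟨ +-congˡ (+-identityʳ 0#) ⟩
      z ^ 3 + 0#
        ≈⟨ +-identityʳ _ ⟩
      z ^ 3 ∎

open import Data.Nat using (_*_; _^_; _≤_)

lemma3p13 : (m : ℕ) → 1 ≤ m → (K : FiniteField ((2 ^ (2 * m)) * (2 ^ (2 * m)))) →
  let q = 2 ^ (2 * m) in
  let open FiniteField K in
  let open FieldNotions K q in
  ((2 ≤ m →
      (∃ λ x → CubeK₂ x × ¬ Inₖ x × Cubeₖ (Tr x))
    × (∃ λ x → CubeK₂ x × ¬ Inₖ x × NonCubeₖ (Tr x)))
  × (m ≡ 1 → ∀ x → CubeK₂ x → ¬ Inₖ x → NonCubeₖ (Tr x)))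
  × ((∃ λ x → NonCubeK₂ x × ¬ Inₖ x × Cubeₖ (Tr x))
    × (∃ λ x → NonCubeK₂ x × ¬ Inₖ x × NonCubeₖ (Tr x)))
lemma3p13 (suc zero) _ K =
    ((λ 2≤1 → ⊥-elim (ℕ.<-irrefl ≡.refl 2≤1)) , λ _ → cubes-have-noncube-trace ≡.refl)
  , noncube-with-cube-trace , noncube-with-noncube-trace
  where open Cubes 1 K 1 ≡.refl
lemma3p13 (suc (suc m)) _ K =
    ((λ _ → cube-with-cube-trace 1≤j (m∣m*n (suc (suc m))) , cube-with-noncube-trace) , λ ())
  , noncube-with-cube-trace , noncube-with-noncube-trace
  where
  open Cubes (ℕ.pred (2 * suc (suc m))) K (cubeIndex (suc (suc m))) (4^m≡1+3*cubeIndex (suc (suc m)))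
  open CubeWithCubeTrace (ℕ.pred (ℕ.pred (2 * suc (suc m)))) K
  1≤j : 1 ≤ ℕ.pred (ℕ.pred (2 * suc (suc m)))
  1≤j = ℕ.≤-trans (s≤s z≤n) (ℕ.m≤n+m _ m)
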